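{- Let $\Sigma$ be an action signature. Let $\varphi$ be a sentence of $\mathcal L(\Sigma)$ and $\alpha$ a program of $\mathcal L(\Sigma)$. Then (1) $[\![\varphi]\!]$ is preserved by bisimulation: whenever $(\mathbf S,s)$ and $(\mathbf T,t)$ are bisimilar, $s\in[\![\varphi]\!]_{\mathbf S}$ iff $t\in[\![\varphi]\!]_{\mathbf T}$; (2) the update induced by $\alpha$ is standard and preserves bisimulations.
   Context: Fix AtSen and Agents. A state model is $\mathbf S=(S,(\to_A)_{A\in\mathrm{Agents}},\|\cdot\|)$. An action signature $\Sigma$: a finite set with relations $\to_A$ and an enumeration $\sigma_1,\dots,\sigma_n$. $\mathcal L(\Sigma)$: sentences $\mathsf{true}\mid p\mid\neg\varphi\mid\varphi\wedge\psi\mid\Box_A\varphi\mid\Box^*_B\varphi\mid[\pi]\varphi$; programs $\mathsf{skip}\mid\mathsf{crash}\mid\sigma_i\psi_1\cdots\psi_n\mid\pi\cup\rho\mid\pi;\rho\mid\pi^*$. Each program $\pi$ induces an update: for every $\mathbf S$ a state model $\mathbf S(\pi)$ and a relation $\pi_{\mathbf S}\subseteq S\times S(\pi)$. $\mathsf{skip}$: $\mathbf S$ with identity; $\mathsf{crash}$: empty model and relation; $\sigma_i\vec\psi$: states $(s,\sigma_j)$ with $s\in[\![\psi_j]\!]_{\mathbf S}$, $(s,\sigma_j)\to_A(t,\sigma_k)$ iff $s\to_A t$ and $\sigma_j\to_A\sigma_k$ in $\Sigma$, valuation inherited from $s$, relation $\{(s,(s,\sigma_i)):s\in[\![\psi_i]\!]_{\mathbf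 S}\}$; $\pi;\rho$: model $\mathbf S(\pi)(\rho)$ with composed relation; $\pi\cup\rho$: disjoint union of the models with union of relations; $\pi^*$: disjoint union over $m\ge0$ of $\pi^m$ ($\pi^0=\mathsf{skip}$, $\pi^{m+1}=\pi^m;\pi$). Sentences: $\Box_A$ via $\to_A$, $\Box^*_B$ via the reflexive-transitive closure of $\bigcup_{A\in B}\to_A$, $s\in[\![[\pi]\varphi]\!]_{\mathbf S}$ iff all $\pi_{\mathbf S}$-successors of $s$ are in $[\![\varphi]\!]_{\mathbf S(\pi)}$. A bisimulation between $\mathbf S$ and $\mathbf T$ is $R\subseteq S\times T$ such that if $sRt$ then $s,t$ satisfy the same atomic sentences, every $s\to_A s'$ is matched by some $t\to_A t'$ with $s'Rt'$, and vice versa; $(\mathbf S,s)$ and $(\mathbf T,t)$ are bisimilar ($\equiv$) if some bisimulation relates $s$ and $t$. An update is standard if for every $\mathbf S$ the inverse of its relation $\pi_{\mathbf S}$ is a partial function. An update preserves bisimulations if whenever $(\mathbf S,s)\equiv(\mathbf T,t)$: for every $s'$ with $s\,\pi_{\mathbf S}\,s'$ there is $t'$ with $t\,\pi_{\mathbf T}\,t'$ and $(\mathbf S(\pi),s')\equiv(\mathbf T(\pi),t')$, and symmetrically. -}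

module Defs where

open import Data.Nat using (ℕ; zero; suc)
open import Data.Fin using (Fin)
open import Data.Bool using (Bool; true; false)
open import Data.Empty using (⊥)
open import Data.Unit using (⊤)
open import Data.Product using (Σ; ∃; _×_; _,_)
open import Function.Bundles using (_⇔_)
open import Relation.Binary.PropositionalEquality using (_≡_)
open import Relation.Binary.Construct.Closure.ReflexiveTransitive using (Star)

-- Action signature over a type of agents: a finite set of actions, given
-- through its enumeration σ_1..σ_n as Fin size, with relations →_A.
record ActionSignature (Agents : Set) : Set₁ where
  field
    size : ℕ
    arr  : Agents → Fin size → Fin size → Set

module Models (AtSen Agents : Set) where

  record Model : Set₁ where
    field
      St  : Set
      arr : Agents → St → St → Set
      val : AtSen → St → Set
  open Model public

  emptyModel : Model
  emptyModel = record { St = ⊥ ; arr = λ _ _ _ → ⊥ ; val = λ _ _ → ⊥ }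

  data UArr {I : Set} (F : I → Model) (A : Agents) : Σ I (λ i → St (F i)) → Σ I (λ i → St (F i)) → Set where
    inn : ∀ {i x y} → arr (F i) A x y → UArr F A (i , x) (i , y)

  ⨄ : {I : Set} → (I → Model) → Model
  ⨄ {I} F = record
    { St  = Σ I (λ i → St (F i))
    ; arr = UArr F
    ; val = λ { p (i , x) → val (F i) p x }
    }

  record IsBisimulation (S T : Model) (R : St S → St T → Set) : Set where
    field
      atoms : ∀ {s t} → R s t → (p : AtSen) → val S p s ⇔ val T p t
      forth : ∀ {s t} → R s t → (A : Agents) (s' : St S) → arr S A s s' →
              Σ (St T) (λ t' → arr T A t t' × R s' t')
      back  : ∀ {s t} → R s t → (A : Agents) (t' : St T) → arr T A t t' →
              Σ (St S) (λ s' → arr S A s s' × R s' t')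

  Bisimilar : (S : Model) (s : St S) (T : Model) (t : St T) → Set₁
  Bisimilar S s T t =
    Σ (St S → St T → Set) (λ R → IsBisimulation S T R × R s t)

module Language (AtSen Agents : Set) (Sig : ActionSignature Agents) where
  open Models AtSen Agents public
  open ActionSignature Sig using (size) renaming (arr to sarr)

  infixr 6 _∧'_
  mutual
    data Sentence : Set₁ where
      true'  : Sentence
      atom   : AtSen → Sentence
      ¬'_    : Sentence → Sentence
      _∧'_   : Sentence → Sentence → Sentence
      □      : Agents → Sentence → Sentence
      □*     : (Agents → Set) → Sentence → Sentence
      [_]_   : Program → Sentence → Sentence

    data Program : Set₁ where
      skip  : Program
      crash : Program
      act   : Fin size → (Fin size → Sentence) → Program
      _∪'_  : Program → Program → Program
      _⨾_   : Program → Program → Program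
      _*'   : Program → Program

  mutual
    sat : (S : Model) → Sentence → St S → Set
    sat S true' s = ⊤
    sat S (atom p) s = val S p s
    sat S (¬' φ) s = sat S φ s → ⊥
    sat S (φ ∧' ψ) s = sat S φ s × sat S ψ s
    sat S (□ A φ) s = (t : St S) → arr S A s t → sat S φ t
    sat S (□* B φ) s =
      (t : St S) → Star (λ x y → Σ Agents (λ A → B A × arr S A x y)) s t → sat S φ t
    sat S ([ π ] φ) s = (s' : St (upd π S)) → rel π S s s' → sat (upd π S) φ s'

    upd : Program → Model → Model
    upd skip S = S
    upd crash S = emptyModel
    upd (act i ψ) S = record
      { St  = Σ (St S × Fin size) (λ { (s , j) → sat S (ψ j) s })
      ; arr = λ { A ((s , j) , _) ((t , k) , _) → arr S A s t × sarr A j k }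
      ; val = λ { p ((s , _) , _) → val S p s }
      }
    upd (π ∪' ρ) S = ⨄ {Bool} (λ { true → upd π S ; false → upd ρ S })
    upd (π ⨾ ρ) S = upd ρ (upd π S)
    upd (π *') S = ⨄ (λ m → iter π m S)

    iter : Program → ℕ → Model → Model
    iter π zero S = S
    iter π (suc m) S = upd π (iter π m S)

    rel : (π : Program) (S : Model) → St S → St (upd π S) → Set
    rel skip S s s' = s ≡ s'
    rel crash S s ()
    rel (act i ψ) S s ((s' , j) , _) = (s ≡ s') × (j ≡ i)
    rel (π ∪' ρ) S s (true , x) = rel π S s x
    rel (π ∪' ρ) S s (false , x) = rel ρ S s x
    rel (π ⨾ ρ) S s u = Σ (St (upd π S)) (λ m → rel π S s m × rel ρ (upd π S) m u)
    rel (π *') S s (m , x) = relIter π m S s x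

    relIter : (π : Program) (m : ℕ) (S : Model) → St S → St (iter π m S) → Set
    relIter π zero S s x = s ≡ x
    relIter π (suc m) S s x =
      Σ (St (iter π m S)) (λ y → relIter π m S s y × rel π (iter π m S) y x)

  Standard : Program → Set₁
  Standard π = (S : Model) {s₁ s₂ : St S} {u : St (upd π S)} →
    rel π S s₁ u → rel π S s₂ u → s₁ ≡ s₂

  PreservesBisim : Program → Set₁
  PreservesBisim π = (S T : Model) (s : St S) (t : St T) → Bisimilar S s T t →
    ((s' : St (upd π S)) → rel π S s s' →
       Σ (St (upd π T)) (λ t' → rel π T t t' × Bisimilar (upd π S) s' (upd π T) t'))
    × ((t' : St (upd π T)) → rel π T t t' →
       Σ (St (upd π S)) (λ s' → rel π S s s' × Bisimilar (upd π S) s' (upd π T) t'))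

-- A bisimulation R between S and T lifts along the update of every program π to a
-- bisimulation between S(π) and T(π) which relates the π-successors of R-related states in
-- both directions.  For σᵢψ⃗ the lifted relation pairs (s, σⱼ) with (t, σⱼ) whenever s R t;
-- it stays inside S(π) × T(π) because the preconditions ψⱼ are themselves invariant, so
-- invariance of sentences and liftability of programs go by one simultaneous induction,
-- [π]φ being handled by the lifting of π.  Every other program construct is built from the
-- identity, composition and disjoint unions of updates, and both liftability and
-- standardness are closed under these.
module Submission where

open import Defs
open import Data.Bool using (Bool; true; false)
open import Data.Fin using (Fin)
open import Data.Nat using (ℕ; zero; suc)
open import Data.Product using (Σ; _×_; _,_; proj₁; proj₂)
open import Data.Empty using (⊥-elim)
open import Data.Unit using (tt)
open import Function.Bundles using (_⇔_; mk⇔; Equivalence)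
open import Relation.Binary.PropositionalEquality using (_≡_; refl)
open import Relation.Binary.Construct.Closure.ReflexiveTransitive using (Star; ε; _◅_)

module Bisimulations (AtSen Agents : Set) where
  open Models AtSen Agents
  open IsBisimulation

  StateRel : Model → Model → Set₁
  StateRel S T = St S → St T → Set

  converse : {S T : Model} {R : StateRel S T} →
             IsBisimulation S T R → IsBisimulation T S (λ t s → R s t)
  converse isB = record
    { atoms = λ r p → mk⇔ (Equivalence.from (atoms isB r p)) (Equivalence.to (atoms isB r p))
    ; forth = back isB
    ; back  = forth isB
    }

  Bisimilar-sym : {S T : Model} {s : St S} {t : St T} → Bisimilar S s T t → Bisimilar T t S s
  Bisimilar-sym (R , isB , r) = (λ t s → R s t) , converse isB , r

  Reach : (S : Model) (B : Agents → Set) → St S → St S → Set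
  Reach S B = Star (λ x y → Σ Agents (λ A → B A × arr S A x y))

  Reach-back : {S T : Model} {R : StateRel S T} → IsBisimulation S T R → (B : Agents → Set) →
               ∀ {s t t'} → R s t → Reach T B t t' → Σ (St S) (λ s' → Reach S B s s' × R s' t')
  Reach-back isB B r ε = _ , ε , r
  Reach-back isB B r (_◅_ {j = t₁} (A , b , a) path) =
    let (s₁ , a₁ , r₁) = back isB r A t₁ a
        (s' , path' , r') = Reach-back isB B r₁ path
    in s' , (A , b , a₁) ◅ path' , r'

  data ⨄-Rel {I : Set} {X Y : I → Set} (R : ∀ i → X i → Y i → Set) : Σ I X → Σ I Y → Set where
    inj : ∀ {i x y} → R i x y → ⨄-Rel R (i , x) (i , y)

  ⨄-isBisimulation : {I : Set} {F G : I → Model} (R : ∀ i → St (F i) → St (G i) → Set) →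
    (∀ i → IsBisimulation (F i) (G i) (R i)) → IsBisimulation (⨄ F) (⨄ G) (⨄-Rel R)
  ⨄-isBisimulation {F = F} {G} R isB = record
    { atoms = λ { (inj {i} r) → atoms (isB i) r }
    ; forth = forth′
    ; back  = back′
    }
    where
    forth′ : ∀ {s t} → ⨄-Rel R s t → (A : Agents) (s' : St (⨄ F)) → arr (⨄ F) A s s' →
             Σ (St (⨄ G)) (λ t' → arr (⨄ G) A t t' × ⨄-Rel R s' t')
    forth′ (inj {i} r) A (_ , x') (inn a) =
      let (y' , b , r') = forth (isB i) r A x' a in (i , y') , inn b , inj r'
    back′ : ∀ {s t} → ⨄-Rel R s t → (A : Agents) (t' : St (⨄ G)) → arr (⨄ G) A t t' →
            Σ (St (⨄ F)) (λ s' → arr (⨄ F) A s s' × ⨄-Rel R s' t')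
    back′ (inj {i} r) A (_ , y') (inn b) =
      let (x' , a , r') = back (isB i) r A y' b in (i , x') , inn a , inj r'

module Updates (AtSen Agents : Set) where
  open Models AtSen Agents
  open Bisimulations AtSen Agents

  record Update : Set₁ where
    field
      model : Model → Model
      step  : (S : Model) → St S → St (model S) → Set
  open Update public

  idUpdate : Update
  idUpdate = record { model = λ S → S ; step = λ _ → _≡_ }

  _⊙_ : Update → Update → Update
  u ⊙ v = record
    { model = λ S → model v (model u S)
    ; step  = λ S s x → Σ (St (model u S)) (λ m → step u S s m × step v (model u S) m x)
    }

  ⋃ : {I : Set} → (I → Update) → Update
  ⋃ u = record
    { model = λ S → ⨄ (λ i → model (u i) S)
    ; step  = λ S s x → step (u (proj₁ x)) S s (proj₂ x)
    }

  record Lifting (u : Update) (S T : Model) (R : StateRel S T) : Set₁ where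
    field
      lifted                : St (model u S) → St (model u T) → Set
      lifted-isBisimulation : IsBisimulation (model u S) (model u T) lifted
      step-forth : ∀ {s t s'} → R s t → step u S s s' →
                   Σ (St (model u T)) (λ t' → step u T t t' × lifted s' t')
      step-back  : ∀ {s t t'} → R s t → step u T t t' →
                   Σ (St (model u S)) (λ s' → step u S s s' × lifted s' t')
  open Lifting public

  LiftsBisimulations : Update → Set₁
  LiftsBisimulations u = ∀ {S T} {R : StateRel S T} → IsBisimulation S T R → Lifting u S T R

  idUpdate-lifts : LiftsBisimulations idUpdate
  idUpdate-lifts {R = R} isB = record
    { lifted                = R
    ; lifted-isBisimulation = isB
    ; step-forth            = λ { r refl → _ , refl , r }
    ; step-back             = λ { r refl → _ , refl , r }
    }

  ⊙-lifts : ∀ {u v} → LiftsBisimulations u → LiftsBisimulations v → LiftsBisimulations (u ⊙ v)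
  ⊙-lifts liftsU liftsV isB = record
    { lifted                = lifted L₂
    ; lifted-isBisimulation = lifted-isBisimulation L₂
    ; step-forth = λ r (m , p , q) →
        let (m' , p' , rm) = step-forth L₁ r p
            (x' , q' , rx) = step-forth L₂ rm q
        in x' , (m' , p' , q') , rx
    ; step-back  = λ r (m , p , q) →
        let (m' , p' , rm) = step-back L₁ r p
            (x' , q' , rx) = step-back L₂ rm q
        in x' , (m' , p' , q') , rx
    }
    where
    L₁ = liftsU isB
    L₂ = liftsV (lifted-isBisimulation L₁)

  ⋃-lifts : {I : Set} {u : I → Update} → (∀ i → LiftsBisimulations (u i)) →
            LiftsBisimulations (⋃ u)
  ⋃-lifts lifts isB = record
    { lifted                = ⨄-Rel (λ i → lifted (L i))
    ; lifted-isBisimulation = ⨄-isBisimulation _ (λ i → lifted-isBisimulation (L i))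
    ; step-forth = λ { {s' = i , _} r p → let (y , q , ry) = step-forth (L i) r p in (i , y) , q , inj ry }
    ; step-back  = λ { {t' = i , _} r p → let (y , q , ry) = step-back (L i) r p in (i , y) , q , inj ry }
    }
    where
    L = λ i → lifts i isB

  IsStandard : Update → Set₁
  IsStandard u = (S : Model) {s₁ s₂ : St S} {x : St (model u S)} →
    step u S s₁ x → step u S s₂ x → s₁ ≡ s₂

  idUpdate-standard : IsStandard idUpdate
  idUpdate-standard S refl refl = refl

  ⊙-standard : ∀ {u v} → IsStandard u → IsStandard v → IsStandard (u ⊙ v)
  ⊙-standard {u} stdU stdV S (_ , p₁ , q₁) (_ , p₂ , q₂) with stdV (model u S) q₁ q₂
  ... | refl = stdU S p₁ p₂

  ⋃-standard : {I : Set} {u : I → Update} → (∀ i → IsStandard (u i)) → IsStandard (⋃ u)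
  ⋃-standard std S {x = i , _} = std i S

module Invariance (AtSen Agents : Set) (Sig : ActionSignature Agents) where
  open Language AtSen Agents Sig
  open Bisimulations AtSen Agents using (Bisimilar-sym; Reach-back; ⨄-isBisimulation; inj)
  open Updates AtSen Agents
  open ActionSignature Sig using (size)
  open IsBisimulation

  ⟦_⟧ : Program → Update
  ⟦ π ⟧ = record { model = upd π ; step = rel π }

  iterate : Program → ℕ → Update
  iterate π m = record { model = iter π m ; step = relIter π m }

  Invariant : Sentence → Set₁
  Invariant φ = ∀ {S T : Model} {s : St S} {t : St T} → Bisimilar S s T t → sat S φ s → sat T φ t

  act-lifts : (i : Fin size) (ψ : Fin size → Sentence) → (∀ j → Invariant (ψ j)) →
              LiftsBisimulations ⟦ act i ψ ⟧
  act-lifts i ψ ψ-invariant {S} {T} {R} isB = record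
    { lifted                = sameAction
    ; lifted-isBisimulation = record
        { atoms = λ (r , _) → atoms isB r
        ; forth = λ {x} {y} → forth′ {x} {y}
        ; back  = λ {x} {y} → back′ {x} {y}
        }
    ; step-forth = λ { {t = t} {s' = _ , p} r (refl , refl) →
        ((t , i) , ψ-invariant i (R , isB , r) p) , (refl , refl) , (r , refl) }
    ; step-back  = λ { {s = s} {t' = _ , p} r (refl , refl) →
        ((s , i) , ψ-invariant i (Bisimilar-sym (R , isB , r)) p) , (refl , refl) , (r , refl) }
    }
    where
    U = upd (act i ψ) S
    V = upd (act i ψ) T

    sameAction : St U → St V → Set
    sameAction ((s , j) , _) ((t , k) , _) = R s t × j ≡ k

    forth′ : ∀ {x y} → sameAction x y → (A : Agents) (x' : St U) → arr U A x x' →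
             Σ (St V) (λ y' → arr V A y y' × sameAction x' y')
    forth′ {(_ , j) , _} {(_ , .j) , _} (r , refl) A ((s' , j') , p) (a , σ) =
      let (t' , b , r') = forth isB r A s' a
      in ((t' , j') , ψ-invariant j' (R , isB , r') p) , (b , σ) , (r' , refl)

    back′ : ∀ {x y} → sameAction x y → (A : Agents) (y' : St V) → arr V A y y' →
            Σ (St U) (λ x' → arr U A x x' × sameAction x' y')
    back′ {(_ , j) , _} {(_ , .j) , _} (r , refl) A ((t' , j') , p) (b , σ) =
      let (s' , a , r') = back isB r A t' b
      in ((s' , j') , ψ-invariant j' (Bisimilar-sym (R , isB , r')) p) , (a , σ) , (r' , refl)

  ∪-lifts : ∀ {π ρ} → LiftsBisimulations ⟦ π ⟧ → LiftsBisimulations ⟦ ρ ⟧ →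
            LiftsBisimulations ⟦ π ∪' ρ ⟧
  ∪-lifts liftsπ liftsρ isB = record
    -- solved by unification: the branch family of S(π ∪ ρ) is an anonymous function of Defs
    { lifted                = _
    ; lifted-isBisimulation =
        ⨄-isBisimulation (λ { true → lifted Lπ ; false → lifted Lρ })
                         (λ { true → lifted-isBisimulation Lπ ; false → lifted-isBisimulation Lρ })
    ; step-forth = λ
        { {s' = true  , _} r p → let (y , q , ry) = step-forth Lπ r p in (true  , y) , q , inj ry
        ; {s' = false , _} r p → let (y , q , ry) = step-forth Lρ r p in (false , y) , q , inj ry }
    ; step-back  = λ
        { {t' = true  , _} r p → let (y , q , ry) = step-back Lπ r p in (true  , y) , q , inj ry
        ; {t' = false , _} r p → let (y , q , ry) = step-back Lρ r p in (false , y) , q , inj ry }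
    }
    where
    Lπ = liftsπ isB
    Lρ = liftsρ isB

  iterate-lifts : ∀ {π} → LiftsBisimulations ⟦ π ⟧ → ∀ m → LiftsBisimulations (iterate π m)
  iterate-lifts lifts zero    = idUpdate-lifts
  iterate-lifts lifts (suc m) = ⊙-lifts (iterate-lifts lifts m) lifts

  crash-lifts : LiftsBisimulations ⟦ crash ⟧
  crash-lifts isB = record
    { lifted                = λ ()
    ; lifted-isBisimulation = record { atoms = λ {} ; forth = λ {} ; back = λ {} }
    ; step-forth            = λ {_} {_} {s'} → ⊥-elim s'
    ; step-back             = λ {_} {_} {t'} → ⊥-elim t'
    }

  mutual
    invariant : (φ : Sentence) → Invariant φ
    invariant true'      _ _ = tt
    invariant (atom p)   (_ , isB , r) = Equivalence.to (atoms isB r p)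
    invariant (¬' φ)     b ¬φ φ' = ¬φ (invariant φ (Bisimilar-sym b) φ')
    invariant (φ ∧' ψ)   b (hφ , hψ) = invariant φ b hφ , invariant ψ b hψ
    invariant (□ A φ)    (R , isB , r) h t' a =
      let (s' , a' , r') = back isB r A t' a in invariant φ (R , isB , r') (h s' a')
    invariant (□* B φ)   (R , isB , r) h t' path =
      let (s' , path' , r') = Reach-back isB B r path in invariant φ (R , isB , r') (h s' path')
    invariant ([ π ] φ)  (R , isB , r) h t' p =
      let L = lifts π isB
          (s' , p' , r') = step-back L r p
      in invariant φ (lifted L , lifted-isBisimulation L , r') (h s' p')

    lifts : (π : Program) → LiftsBisimulations ⟦ π ⟧
    lifts skip      = idUpdate-lifts
    lifts crash     = crash-lifts
    lifts (act i ψ) = act-lifts i ψ (λ j → invariant (ψ j))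
    lifts (π ∪' ρ)  = ∪-lifts (lifts π) (lifts ρ)
    lifts (π ⨾ ρ)   = ⊙-lifts (lifts π) (lifts ρ)
    lifts (π *')    = ⋃-lifts (iterate-lifts (lifts π))

  iterate-standard : ∀ {π} → IsStandard ⟦ π ⟧ → ∀ m → IsStandard (iterate π m)
  iterate-standard     std zero    = idUpdate-standard
  iterate-standard {π} std (suc m) = ⊙-standard {iterate π m} {⟦ π ⟧} (iterate-standard std m) std

  standard : (π : Program) → Standard π
  standard skip                              = idUpdate-standard
  standard crash     S {u = ()}
  standard (act i ψ) S (refl , _) (refl , _) = refl
  standard (π ∪' ρ)  S {u = true  , _}       = standard π S
  standard (π ∪' ρ)  S {u = false , _}       = standard ρ S
  standard (π ⨾ ρ)                           = ⊙-standard {⟦ π ⟧} {⟦ ρ ⟧} (standard π) (standard ρ)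
  standard (π *')                            = ⋃-standard {u = iterate π} (iterate-standard {π} (standard π))

  preservesBisim : (π : Program) → PreservesBisim π
  preservesBisim π S T s t (R , isB , r) =
    (λ s' p → let (t' , q , r') = step-forth L r p in t' , q , (lifted L , lifted-isBisimulation L , r')) ,
    (λ t' q → let (s' , p , r') = step-back L r q in s' , p , (lifted L , lifted-isBisimulation L , r'))
    where
    L = lifts π isB

mainTheorem15 : (AtSen Agents : Set) (Sig : ActionSignature Agents) →
    let open Language AtSen Agents Sig in
    ((φ : Sentence) (S T : Model) (s : St S) (t : St T) →
    Bisimilar S s T t → (sat S φ s ⇔ sat T φ t))
    × ((α : Program) → Standard α × PreservesBisim α)
mainTheorem15 AtSen Agents Sig =
  (λ φ S T s t b → mk⇔ (invariant φ b) (invariant φ (Bisimilar-sym b))) ,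
  (λ α → standard α , preservesBisim α)
  where
  open Bisimulations AtSen Agents using (Bisimilar-sym)
  open Invariance AtSen Agents Sig
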